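{- Let $\Sigma$ be an alphabet and $L\subseteq\Sigma^*$ a finite language. Then every regular expression $R$ with $L(R)=L$ satisfies $\mathrm{sz}(R)\ge\log_2|L|$.
   Context: Regular expressions (RE) over $\Sigma$: $\emptyset$, $\epsilon$ and each $a\in\Sigma$ are RE; if $R_1,R_2$ are RE then so are $R_1\cup R_2$, $R_1R_2$, $R_1^*$, with the usual languages $L(R)$. Size: $\mathrm{sz}(\emptyset)=\mathrm{sz}(\epsilon)=\mathrm{sz}(a)=1$, $\mathrm{sz}(R^*)=\mathrm{sz}(R)+1$, $\mathrm{sz}(R_1\cup R_2)=\mathrm{sz}(R_1R_2)=\mathrm{sz}(R_1)+\mathrm{sz}(R_2)+1$. -}

module Defs where

open import Level using (Level)
open import Data.Nat using (ℕ; suc; _+_)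
open import Data.List using (List; []; _∷_; _++_)
open import Data.Product using (∃₂; _×_)
open import Relation.Binary.PropositionalEquality using (_≡_)

data RE {a : Level} (Σ : Set a) : Set a where
  ∅   : RE Σ
  ε   : RE Σ
  chr : Σ → RE Σ
  _∪_ : RE Σ → RE Σ → RE Σ
  _·_ : RE Σ → RE Σ → RE Σ
  _*  : RE Σ → RE Σ

sz : ∀ {a} {Σ : Set a} → RE Σ → ℕ
sz ∅ = 1
sz ε = 1
sz (chr x) = 1
sz (r ∪ s) = sz r + sz s + 1
sz (r · s) = sz r + sz s + 1
sz (r *) = suc (sz r)

data _∈ℒ_ {a : Level} {Σ : Set a} : List Σ → RE Σ → Set a where
  ∈ε    : [] ∈ℒ ε
  ∈chr  : ∀ x → (x ∷ []) ∈ℒ chr x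
  ∈∪ˡ   : ∀ {w r s} → w ∈ℒ r → w ∈ℒ (r ∪ s)
  ∈∪ʳ   : ∀ {w r s} → w ∈ℒ s → w ∈ℒ (r ∪ s)
  ∈·    : ∀ {u v r s} → u ∈ℒ r → v ∈ℒ s → (u ++ v) ∈ℒ (r · s)
  ∈*[]  : ∀ {r} → [] ∈ℒ (r *)
  ∈*∷   : ∀ {u v r} → u ∈ℒ r → v ∈ℒ (r *) → (u ++ v) ∈ℒ (r *)

-- If L(R) is finite then no starred subexpression of R can match a nonempty
-- word u, since u, uu, uuu, … would all lie in L(R).  So every word of L(R)
-- is produced by R with each star read as ε, and an induction on R shows that
-- this star-free reading produces at most 2 ^ sz R words: the counts add under
-- ∪ and multiply under ·, both within 2 ^ (m + n + 1).

module Submission where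

open import Defs
open import Data.Nat using (ℕ; zero; suc; _+_; _*_; _≤_; _^_; s≤s; z≤n)
open import Data.Nat.Properties
open import Data.Fin using (Fin; zero; suc)
open import Data.Fin.Properties using (injective⇒≤)
open import Data.List using (List; []; _∷_; _++_; [_]; length; lookup; map; concat; replicate;
                             cartesianProductWith)
open import Data.List.Properties using (length-++; length-map; length-++-≤ˡ; length-++-≤ʳ)
open import Data.List.Extrema.Nat using (argmax; f[xs]≤f[argmax])
open import Data.List.Membership.Propositional using (_∈_)
open import Data.List.Membership.Propositional.Properties using (∈-lookup; ∈-++⁺ˡ; ∈-++⁺ʳ)
open import Data.List.Relation.Binary.Subset.Propositional using (_⊆_)
open import Data.List.Relation.Unary.All as All using ()
open import Data.List.Relation.Unary.Any using (here; index)
open import Data.List.Relation.Unary.Any.Properties using (lookup-index; cartesianProductWith⁺)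
open import Data.List.Relation.Unary.Unique.Propositional using (Unique; _∷_)
open import Data.Empty using (⊥-elim)
open import Function.Base using (_∘_)
open import Function.Bundles using (_⇔_; Equivalence)
open import Relation.Nullary using (¬_)
open import Relation.Binary.PropositionalEquality using (_≡_; refl; sym; trans; cong; cong₂; module ≡-Reasoning)

module _ {a} {A : Set a} where

  lookup-injective : ∀ {xs : List A} → Unique xs → ∀ {i j} → lookup xs i ≡ lookup xs j → i ≡ j
  lookup-injective (_ ∷ _)    {zero}  {zero}  _  = refl
  lookup-injective (x∉ ∷ _)   {zero}  {suc j} eq = ⊥-elim (All.lookup x∉ (∈-lookup j) eq)
  lookup-injective (x∉ ∷ _)   {suc i} {zero}  eq = ⊥-elim (All.lookup x∉ (∈-lookup i) (sym eq))
  lookup-injective (_ ∷ xs!)  {suc i} {suc j} eq = cong suc (lookup-injective xs! eq)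

  Unique⇒length≤ : ∀ {xs ys : List A} → Unique xs → xs ⊆ ys → length xs ≤ length ys
  Unique⇒length≤ {xs} {ys} xs! xs⊆ys = injective⇒≤ position-injective
    where
    position : Fin (length xs) → Fin (length ys)
    position i = index (xs⊆ys (∈-lookup i))
    position-injective : ∀ {i j} → position i ≡ position j → i ≡ j
    position-injective {i} {j} eq = lookup-injective xs!
      (trans (lookup-index (xs⊆ys (∈-lookup i)))
        (trans (cong (lookup ys) eq) (sym (lookup-index (xs⊆ys (∈-lookup j))))))

  length-cartesianProductWith : ∀ {B C : Set a} (f : A → B → C) xs ys →
    length (cartesianProductWith f xs ys) ≡ length xs * length ys
  length-cartesianProductWith f []       ys = refl
  length-cartesianProductWith f (x ∷ xs) ys =
    trans (length-++ (map (f x) ys))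
          (cong₂ _+_ (length-map (f x) ys) (length-cartesianProductWith f xs ys))

  n≤length-concat-replicate : ∀ n (x : A) u → n ≤ length (concat (replicate n (x ∷ u)))
  n≤length-concat-replicate zero    x u = z≤n
  n≤length-concat-replicate (suc n) x u =
    s≤s (≤-trans (n≤length-concat-replicate n x u) (length-++-≤ʳ (concat (replicate n (x ∷ u))) {u}))

2^[m+n+1]≡2^m*2^n+2^m*2^n : ∀ m n → 2 ^ (m + n + 1) ≡ 2 ^ m * 2 ^ n + 2 ^ m * 2 ^ n
2^[m+n+1]≡2^m*2^n+2^m*2^n m n = begin
  2 ^ (m + n + 1)         ≡⟨ ^-distribˡ-+-* 2 (m + n) 1 ⟩
  2 ^ (m + n) * 2         ≡⟨ *-comm (2 ^ (m + n)) 2 ⟩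
  2 * 2 ^ (m + n)         ≡⟨ cong (λ k → 2 * k) (^-distribˡ-+-* 2 m n) ⟩
  2 * (2 ^ m * 2 ^ n)     ≡⟨ cong (2 ^ m * 2 ^ n +_) (+-identityʳ (2 ^ m * 2 ^ n)) ⟩
  2 ^ m * 2 ^ n + 2 ^ m * 2 ^ n ∎
  where open ≡-Reasoning

+-bounded-by-2^[m+n+1] : ∀ {x y} m n → x ≤ 2 ^ m → y ≤ 2 ^ n → x + y ≤ 2 ^ (m + n + 1)
+-bounded-by-2^[m+n+1] {x} {y} m n x≤ y≤ = begin
  x + y                           ≤⟨ +-mono-≤ x≤ y≤ ⟩
  2 ^ m + 2 ^ n                   ≤⟨ +-mono-≤ (m≤m*n (2 ^ m) (2 ^ n) {{m^n≢0 2 n}})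
                                              (m≤n*m (2 ^ n) (2 ^ m) {{m^n≢0 2 m}}) ⟩
  2 ^ m * 2 ^ n + 2 ^ m * 2 ^ n   ≡⟨ 2^[m+n+1]≡2^m*2^n+2^m*2^n m n ⟨
  2 ^ (m + n + 1)                 ∎
  where open ≤-Reasoning

*-bounded-by-2^[m+n+1] : ∀ {x y} m n → x ≤ 2 ^ m → y ≤ 2 ^ n → x * y ≤ 2 ^ (m + n + 1)
*-bounded-by-2^[m+n+1] {x} {y} m n x≤ y≤ = begin
  x * y                           ≤⟨ *-mono-≤ x≤ y≤ ⟩
  2 ^ m * 2 ^ n                   ≤⟨ m≤m+n (2 ^ m * 2 ^ n) (2 ^ m * 2 ^ n) ⟩
  2 ^ m * 2 ^ n + 2 ^ m * 2 ^ n   ≡⟨ 2^[m+n+1]≡2^m*2^n+2^m*2^n m n ⟨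
  2 ^ (m + n + 1)                 ∎
  where open ≤-Reasoning

module _ {a} {Σ : Set a} where

  starFreeWords : RE Σ → List (List Σ)
  starFreeWords ∅       = []
  starFreeWords ε       = [ [] ]
  starFreeWords (chr x) = [ x ∷ [] ]
  starFreeWords (r ∪ s) = starFreeWords r ++ starFreeWords s
  starFreeWords (r · s) = cartesianProductWith _++_ (starFreeWords r) (starFreeWords s)
  starFreeWords (r *)   = [ [] ]

  length-starFreeWords≤2^sz : ∀ R → length (starFreeWords R) ≤ 2 ^ sz R
  length-starFreeWords≤2^sz ∅       = z≤n
  length-starFreeWords≤2^sz ε       = s≤s z≤n
  length-starFreeWords≤2^sz (chr x) = s≤s z≤n
  length-starFreeWords≤2^sz (r ∪ s) rewrite length-++ (starFreeWords r) {starFreeWords s} =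
    +-bounded-by-2^[m+n+1] (sz r) (sz s) (length-starFreeWords≤2^sz r) (length-starFreeWords≤2^sz s)
  length-starFreeWords≤2^sz (r · s) rewrite length-cartesianProductWith _++_ (starFreeWords r) (starFreeWords s) =
    *-bounded-by-2^[m+n+1] (sz r) (sz s) (length-starFreeWords≤2^sz r) (length-starFreeWords≤2^sz s)
  length-starFreeWords≤2^sz (r *)   = m^n>0 2 (suc (sz r))

  LengthBoundedBy : ℕ → RE Σ → Set a
  LengthBoundedBy B R = ∀ {w} → w ∈ℒ R → length w ≤ B

  concat-replicate-∈ℒ* : ∀ {u : List Σ} {r} → u ∈ℒ r → ∀ n → concat (replicate n u) ∈ℒ (r *)
  concat-replicate-∈ℒ* u∈r zero    = ∈*[]
  concat-replicate-∈ℒ* u∈r (suc n) = ∈*∷ u∈r (concat-replicate-∈ℒ* u∈r n)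

  *-unbounded : ∀ {x : Σ} {u r B} → (x ∷ u) ∈ℒ r → ¬ LengthBoundedBy B (r *)
  *-unbounded {x} {u} {B = B} xu∈r bounded = 1+n≰n (begin
    suc B                                        ≤⟨ n≤length-concat-replicate (suc B) x u ⟩
    length (concat (replicate (suc B) (x ∷ u)))  ≤⟨ bounded (concat-replicate-∈ℒ* xu∈r (suc B)) ⟩
    B                                            ∎)
    where open ≤-Reasoning

  ∈ℒ⇒∈starFreeWords : ∀ {B R w} → LengthBoundedBy B R → w ∈ℒ R → w ∈ starFreeWords R
  ∈ℒ⇒∈starFreeWords bounded ∈ε = here refl
  ∈ℒ⇒∈starFreeWords bounded (∈chr x) = here refl
  ∈ℒ⇒∈starFreeWords bounded (∈∪ˡ w∈r) = ∈-++⁺ˡ (∈ℒ⇒∈starFreeWords (bounded ∘ ∈∪ˡ) w∈r)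
  ∈ℒ⇒∈starFreeWords {R = r ∪ s} bounded (∈∪ʳ w∈s) =
    ∈-++⁺ʳ (starFreeWords r) (∈ℒ⇒∈starFreeWords (bounded ∘ ∈∪ʳ) w∈s)
  ∈ℒ⇒∈starFreeWords bounded (∈· {u} {v} u∈r v∈s) = cartesianProductWith⁺ _++_ (cong₂ _++_)
    (∈ℒ⇒∈starFreeWords (λ {u′} u′∈r → ≤-trans (length-++-≤ˡ u′) (bounded (∈· u′∈r v∈s))) u∈r)
    (∈ℒ⇒∈starFreeWords (λ {v′} v′∈s → ≤-trans (length-++-≤ʳ v′ {u}) (bounded (∈· u∈r v′∈s))) v∈s)
  ∈ℒ⇒∈starFreeWords bounded ∈*[] = here refl
  ∈ℒ⇒∈starFreeWords bounded (∈*∷ {[]} _ v∈r*) = ∈ℒ⇒∈starFreeWords bounded v∈r*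
  ∈ℒ⇒∈starFreeWords bounded (∈*∷ {_ ∷ _} xu∈r _) = ⊥-elim (*-unbounded xu∈r bounded)

proposition7 : ∀ {a} (Σ : Set a) (L : List (List Σ)) → Unique L →
    (R : RE Σ) → (∀ w → w ∈ℒ R ⇔ w ∈ L) →
    length L ≤ 2 ^ sz R
proposition7 Σ L L! R ℒR⇔L = begin
  length L                   ≤⟨ Unique⇒length≤ L! L⊆starFreeWords ⟩
  length (starFreeWords R)   ≤⟨ length-starFreeWords≤2^sz R ⟩
  2 ^ sz R                   ∎
  where
  open ≤-Reasoning
  bounded : LengthBoundedBy (length (argmax length [] L)) R
  bounded {w} w∈ℒR = All.lookup (f[xs]≤f[argmax] [] L) (Equivalence.to (ℒR⇔L w) w∈ℒR)
  L⊆starFreeWords : L ⊆ starFreeWords R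
  L⊆starFreeWords {w} w∈L = ∈ℒ⇒∈starFreeWords bounded (Equivalence.from (ℒR⇔L w) w∈L)
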